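{- For each $\mathcal{C}\in\{\mathrm{Horn},\mathrm{dHorn},\mathrm{Krom}\}$, the parameters $\mathrm{depth}_{\mathcal{C}}$ and $\mathrm{del}_{\mathrm{Q\text{ - }Horn}}$ are domination orthogonal.
   Context: A clause is a finite set of literals with no complementary pair; a CNF formula is a finite set of clauses. For a partial assignment $\tau$, $F[\tau]$ is obtained by deleting clauses containing a true literal and deleting false literals from the remaining clauses. $\mathrm{Conn}(F)$ is the set of connected components of $F$ with respect to its incidence graph. Horn: every clause has at most one positive literal; dHorn: at most one negative literal; Krom: at most two literals. $\mathrm{depth}_{\mathcal{C}}(F)$ is $0$ if $F\in\mathcal{C}$; if $F\notin\mathcal{C}$ and $F$ is connected it is $1+\min_{x\in\mathit{var}(F)}\max_{\epsilon\in\{0,1\}}\mathrm{depth}_{\mathcal{C}}(F[x=\epsilon])$; otherwise it is $\max_{F'\in\mathrm{Conn}(F)}\mathrm{depth}_{\mathcal{C}}(F')$. $F$ is quadratic Horn (class Q-Horn) if there is $f:\mathit{var}(F)\to[0,1]$ such that for every clause $c\in F$, $\sum_{x\in c}f(x)+\sum_{\neg x\in c}(1-f(x))\le1$ (first sum over positive literals, second over negative literals). For $B\subseteq\mathit{var}(F)$, $F-B=\{c\setminus(B\cup\overline{B}) : c\in F\}$, where $\overline{B}=\{\neg x:x\in B\}$. $\mathrm{del}_{\mathrm{Q\text{ - }Horn}}(F)$ is the minimum size of $B\subseteq\mathit{var}(F)$ with $F-B\in$ Q-Horn. For integer-valued parameters $p,q$: $p$ dominates $q$ if every class of formulas on which $q$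 is bounded also has $p$ bounded; $p,q$ are domination orthogonal if neither dominates the other.
   Formalization: The function f witnessing that a formula is quadratic Horn takes values in the rationals of [0,1], which enters the parameter $\mathrm{del}_{\mathrm{Q\text{ - }Horn}}$. -}

module Defs where

open import Data.Nat as ℕ using (ℕ; zero; suc; _≡ᵇ_; _⊔_; _⊓_; _≤ᵇ_)
open import Data.Bool using (Bool; true; false; not; _∧_; if_then_else_; T)
open import Data.List using (List; []; _∷_; map; filter; length; concatMap; foldr; _++_)
open import Data.Bool.ListAction using (any)
open import Data.List.Relation.Unary.All using (All)
open import Data.List.Relation.Unary.All as All using (all?)
open import Data.List.Relation.Unary.Unique.Propositional using (Unique)
open import Data.List.Membership.Propositional using (_∈_)
open import Data.Product using (Σ; ∃; _×_)
open import Data.Rational as ℚ using (ℚ; 0ℚ; 1ℚ)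
open import Relation.Nullary using (¬_; Dec; yes; no; does)
open import Relation.Nullary.Decidable using (T?)

data Lit : Set where
  pos : ℕ → Lit
  neg : ℕ → Lit

var : Lit → ℕ
var (pos x) = x
var (neg x) = x

isPos : Lit → Bool
isPos (pos _) = true
isPos (neg _) = false

-- a clause is a finite set of literals, represented by a list
Clause : Set
Clause = List Lit

CNF : Set
CNF = List Clause

-- a clause (as a list) is a genuine finite set of literals with no
-- complementary pair
WFClause : Clause → Set
WFClause c = Unique c × (∀ x → ¬ (pos x ∈ c × neg x ∈ c))

WF : CNF → Set
WF F = All WFClause F

varsC : Clause → List ℕ
varsC c = map var c

vars : CNF → List ℕ
vars F = concatMap varsC F

memᵇ : ℕ → List ℕ → Bool
memᵇ x V = any (λ y → x ≡ᵇ y) V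

trueLitᵇ : ℕ → Bool → Lit → Bool
trueLitᵇ x ε l = (var l ≡ᵇ x) ∧ (if ε then isPos l else not (isPos l))

_[_≔_] : CNF → ℕ → Bool → CNF
F [ x ≔ ε ] =
  map (filter (λ l → T? (not (var l ≡ᵇ x))))
      (filter (λ c → T? (not (any (trueLitᵇ x ε) c))) F)

countPos : Clause → ℕ
countPos c = length (filter (λ l → T? (isPos l)) c)

countNeg : Clause → ℕ
countNeg c = length (filter (λ l → T? (not (isPos l))) c)

Horn : CNF → Set
Horn F = All (λ c → countPos c ℕ.≤ 1) F

dHorn : CNF → Set
dHorn F = All (λ c → countNeg c ℕ.≤ 1) F

Krom : CNF → Set
Krom F = All (λ c → length c ℕ.≤ 2) F

data BaseClass : Set where
  horn dhorn krom : BaseClass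

_∈𝒞_ : CNF → BaseClass → Set
F ∈𝒞 horn  = Horn F
F ∈𝒞 dhorn = dHorn F
F ∈𝒞 krom  = Krom F

_∈𝒞?_ : (F : CNF) → (𝒞 : BaseClass) → Dec (F ∈𝒞 𝒞)
F ∈𝒞? horn  = all? (λ c → countPos c ℕ.≤? 1) F
F ∈𝒞? dhorn = all? (λ c → countNeg c ℕ.≤? 1) F
F ∈𝒞? krom  = all? (λ c → length c ℕ.≤? 2) F

-- Connected components of the incidence graph

sharesᵇ : List ℕ → Clause → Bool
sharesᵇ V c = any (λ l → memᵇ (var l) V) c

closeV : ℕ → List ℕ → CNF → List ℕ
closeV zero    V F = V
closeV (suc n) V F = closeV n (V ++ vars (filter (λ c → T? (sharesᵇ V c)) F)) F

compsF : ℕ → CNF → List CNF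
compsF zero    F       = []
compsF (suc n) []      = []
compsF (suc n) (c ∷ F) =
  let V = closeV (length F) (varsC c) F in
  (c ∷ filter (λ d → T? (sharesᵇ V d)) F)
    ∷ compsF n (filter (λ d → T? (not (sharesᵇ V d))) F)

Conn : CNF → List CNF
Conn F = compsF (length F) F

maxL : List ℕ → ℕ
maxL = foldr _⊔_ 0

minL : List ℕ → ℕ
minL []       = 0
minL (n ∷ ns) = foldr _⊓_ n ns

-- fuel-bounded evaluation of the recursive definition
depthF : BaseClass → ℕ → CNF → ℕ
depthF 𝒞 zero    F = 0
depthF 𝒞 (suc n) F with does (F ∈𝒞? 𝒞) | Conn F
... | true  | _       = 0
... | false | K ∷ []  =
  suc (minL (map (λ x → depthF 𝒞 n (F [ x ≔ false ]) ⊔ depthF 𝒞 n (F [ x ≔ true ])) (vars F)))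
... | false | Ks      = maxL (map (depthF 𝒞 n) Ks)

-- the fuel 2·|vars F| + 2 is never exhausted (each two recursive steps
-- strictly decrease the length of vars)
depth : BaseClass → CNF → ℕ
depth 𝒞 F = depthF 𝒞 (2 ℕ.* length (vars F) ℕ.+ 2) F

litVal : (ℕ → ℚ) → Lit → ℚ
litVal f (pos x) = f x
litVal f (neg x) = 1ℚ ℚ.- f x

clauseSum : (ℕ → ℚ) → Clause → ℚ
clauseSum f c = foldr (λ l s → litVal f l ℚ.+ s) 0ℚ c

QHorn : CNF → Set
QHorn F = Σ (ℕ → ℚ) λ f →
  (∀ x → x ∈ vars F → (0ℚ ℚ.≤ f x) × (f x ℚ.≤ 1ℚ))
  × All (λ c → clauseSum f c ℚ.≤ 1ℚ) F

_-ᵛ_ : CNF → List ℕ → CNF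
F -ᵛ B = map (filter (λ l → T? (not (memᵇ (var l) B)))) F

DelQHornLe : ℕ → CNF → Set
DelQHornLe k F = Σ (List ℕ) λ B → (length B ℕ.≤ k) × All (_∈ vars F) B × QHorn (F -ᵛ B)

DepthLe : BaseClass → ℕ → CNF → Set
DepthLe 𝒞 k F = depth 𝒞 F ℕ.≤ k

-- Domination
-- A parameter p is given through its sublevel predicates  p F ≤ k.

BoundedOn : (ℕ → CNF → Set) → (CNF → Set) → Set
BoundedOn p P = ∃ λ k → ∀ F → WF F → P F → p k F

Dominates : (ℕ → CNF → Set) → (ℕ → CNF → Set) → Set₁
Dominates p q = ∀ (P : CNF → Set) → BoundedOn q P → BoundedOn p P

DominationOrthogonal : (ℕ → CNF → Set) → (ℕ → CNF → Set) → Set₁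
DominationOrthogonal p q = ¬ Dominates p q × ¬ Dominates q p

{-# OPTIONS --safe #-}
-- A clause of n distinct positive literals (negative ones for dHorn) is Q-Horn, witnessed by the
-- constant valuation 0 (resp. 1), so its Q-Horn deletion distance is 0; but setting a variable to
-- the value falsifying its literal only shortens the clause by one, so its depth is at least n - 3.
-- Conversely, m disjoint pairs x₁ ∨ x₂ ∨ x₃, ¬x₁ ∨ ¬x₂ ∨ ¬x₃ form a formula whose connected
-- components have three variables each, hence depth at most 3; yet the two clause sums of a pair
-- add up to 3 > 1 + 1 under any valuation, so a Q-Horn deletion set must meet all m triples.
module Submission where

open import Defs
open import Data.Bool using (Bool; true; false; not; T)
open import Data.Bool.ListAction using (any)
open import Data.Bool.Properties using (∧-zeroʳ)
open import Data.Empty using (⊥-elim)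
open import Data.List using (List; []; _∷_; map; filter; length; foldr; _++_; upTo)
open import Data.List.Membership.Propositional using (_∈_; _∉_; find)
open import Data.List.Membership.Propositional.Properties
  using (∈-map⁺; ∈-map⁻; ∈-filter⁺; ∈-filter⁻; ∈-concat⁺′; ∈-concat⁻′; ∈-++⁻)
open import Data.List.Properties
  using (filter-all; filter-notAll; length-filter; length-map; length-upTo; ++-identityʳ;
         foldr-preservesᵇ)
open import Data.List.Relation.Binary.Subset.Propositional using (_⊆_)
open import Data.List.Relation.Unary.All as All using (All; []; _∷_)
import Data.List.Relation.Unary.All.Properties as All
open import Data.List.Relation.Unary.AllPairs using ([]; _∷_)
open import Data.List.Relation.Unary.Any as Any using (here; there)
open import Data.List.Relation.Unary.Any.Properties using (any⁻)
open import Data.List.Relation.Unary.Unique.Propositional using (Unique)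
import Data.List.Relation.Unary.Unique.Propositional.Properties as Unique
open import Data.Nat as ℕ using (ℕ; zero; suc; _≡ᵇ_; _⊔_; _⊓_; _≤_; _<_; z≤n; s≤s; _+_; _*_; _/_; _%_)
open import Data.List.Membership.DecPropositional ℕ._≟_ using (_∈?_)
open import Data.Nat.DivMod using (m≡m%n+[m/n]*n; m%n<n; +-distrib-/-∣ʳ; m<n⇒m/n≡0; m*n/n≡m)
open import Data.Nat.Divisibility using (divides)
open import Data.Nat.Properties
  using (≡ᵇ⇒≡; ≡⇒≡ᵇ; ⊓-glb; ⊔-lub; m⊓n≤m; m⊓n≤n; m≤m⊔n; m≤n⊔m; ≤-trans; ≤-refl; ≤-reflexive;
         ≤-pred; <⇒≢; <⇒≱; m≤n+m; m≤m+n; m≤n⇒m≤1+n; 1+n≰n; m<1+n⇒m<n∨m≡n; module ≤-Reasoning)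
open import Data.Product using (∃; _×_; _,_; proj₁; proj₂)
open import Data.Rational as ℚ using (ℚ; 0ℚ; 1ℚ)
import Data.Rational.Properties as ℚ
open import Data.Rational.Solver using (module +-*-Solver)
open import Data.Sum using (inj₁; inj₂)
open import Data.Unit using (tt)
open import Relation.Nullary using (¬_; yes; no)
open import Relation.Nullary.Decidable using (T?; toWitness; toWitnessFalse)
open import Relation.Binary.PropositionalEquality using (_≡_; _≢_; refl; sym; trans; cong; cong₂; subst)

T-not-≡ᵇ⁺ : ∀ {y x} → y ≢ x → T (not (y ≡ᵇ x))
T-not-≡ᵇ⁺ {y} {x} y≢x with y ≡ᵇ x in eq
... | false = tt
... | true  = y≢x (≡ᵇ⇒≡ y x (subst T (sym eq) tt))

T-not-≡ᵇ⁻ : ∀ {y x} → T (not (y ≡ᵇ x)) → y ≢ x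
T-not-≡ᵇ⁻ {y} t refl with y ≡ᵇ y | ≡⇒≡ᵇ y y refl
... | true | _ = t

remove : ℕ → List ℕ → List ℕ
remove x = filter (λ y → T? (not (y ≡ᵇ x)))

∈-remove⁺ : ∀ {x y S} → y ∈ S → y ≢ x → y ∈ remove x S
∈-remove⁺ {x} y∈S y≢x = ∈-filter⁺ (λ y → T? (not (y ≡ᵇ x))) y∈S (T-not-≡ᵇ⁺ y≢x)

length-remove-< : ∀ {x S} → x ∈ S → length (remove x S) < length S
length-remove-< {x} {S} x∈S =
  filter-notAll (λ y → T? (not (y ≡ᵇ x))) S (Any.map (λ { refl t → T-not-≡ᵇ⁻ {x} t refl }) x∈S)

length≤1+length-remove : ∀ x {xs} → Unique xs → length xs ≤ suc (length (remove x xs))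
length≤1+length-remove x {[]} _ = z≤n
length≤1+length-remove x {y ∷ ys} (y∉ys ∷ unique) with y ≡ᵇ x in eq
... | false = s≤s (length≤1+length-remove x unique)
... | true  = s≤s (≤-reflexive (cong length (sym (filter-all _ (All.map not-x y∉ys)))))
  where
  not-x : ∀ {z} → y ≢ z → T (not (z ≡ᵇ x))
  not-x {z} y≢z = T-not-≡ᵇ⁺ {z} {x} λ { refl → y≢z (≡ᵇ⇒≡ y x (subst T (sym eq) tt)) }

∈-memᵇ⁻ : ∀ {y V} → T (memᵇ y V) → y ∈ V
∈-memᵇ⁻ {y} {V} t with find (any⁻ (y ≡ᵇ_) V t)
... | z , z∈V , y≡ᵇz = subst (_∈ V) (sym (≡ᵇ⇒≡ y z y≡ᵇz)) z∈V

∉⇒T-not-memᵇ : ∀ {y V} → y ∉ V → T (not (memᵇ y V))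
∉⇒T-not-memᵇ {y} {V} y∉V with memᵇ y V in eq
... | false = tt
... | true  = y∉V (∈-memᵇ⁻ (subst T (sym eq) tt))

∈-vars⁻ : ∀ {y} F → y ∈ vars F → ∃ λ c → c ∈ F × y ∈ varsC c
∈-vars⁻ F y∈ with ∈-concat⁻′ (map varsC F) y∈
... | _ , y∈vs , vs∈ with ∈-map⁻ varsC vs∈
... | c , c∈F , refl = c , c∈F , y∈vs

∈-vars⁺ : ∀ {y c} F → c ∈ F → y ∈ varsC c → y ∈ vars F
∈-vars⁺ F c∈F y∈c = ∈-concat⁺′ y∈c (∈-map⁺ varsC c∈F)

vars-mono : ∀ {K F} → K ⊆ F → vars K ⊆ vars F
vars-mono {K} {F} K⊆F y∈ with ∈-vars⁻ K y∈
... | c , c∈K , y∈c = ∈-vars⁺ F (K⊆F c∈K) y∈c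

vars-restrict : ∀ {x y} F ε → y ∈ vars (F [ x ≔ ε ]) → y ∈ vars F × y ≢ x
vars-restrict {x} F ε y∈ with ∈-vars⁻ (F [ x ≔ ε ]) y∈
... | _ , c∈ , y∈c with ∈-map⁻ (filter (λ l → T? (not (var l ≡ᵇ x)))) c∈
... | c , c∈F , refl with ∈-map⁻ var y∈c
... | l , l∈ , refl with ∈-filter⁻ (λ l → T? (not (var l ≡ᵇ x))) l∈
... | l∈c , t =
  ∈-vars⁺ F (proj₁ (∈-filter⁻ (λ c → T? (not (any (trueLitᵇ x ε) c))) {xs = F} c∈F)) (∈-map⁺ var l∈c)
  , T-not-≡ᵇ⁻ t

varFree-∈𝒞 : ∀ 𝒞 F → vars F ≡ [] → F ∈𝒞 𝒞
varFree-∈𝒞 𝒞 F noVars = ∈𝒞 𝒞 (empty F noVars)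
  where
  empty : ∀ F → vars F ≡ [] → All (_≡ []) F
  empty []       _  = []
  empty ([] ∷ F) eq = refl ∷ empty F eq
  ∈𝒞 : ∀ 𝒞 {F} → All (_≡ []) F → F ∈𝒞 𝒞
  ∈𝒞 horn  = All.map λ { refl → z≤n }
  ∈𝒞 dhorn = All.map λ { refl → z≤n }
  ∈𝒞 krom  = All.map λ { refl → z≤n }

∉𝒞⇒∃var : ∀ 𝒞 F → ¬ F ∈𝒞 𝒞 → ∃ λ x → x ∈ vars F
∉𝒞⇒∃var 𝒞 F F∉𝒞 with vars F in eq
... | []    = ⊥-elim (F∉𝒞 (varFree-∈𝒞 𝒞 F eq))
... | x ∷ _ = x , here refl

minL-≤ : ∀ {x ns} → x ∈ ns → minL ns ≤ x
minL-≤ {ns = n ∷ ns} = foldr-⊓-≤ n ns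
  where
  foldr-⊓-≤ : ∀ {x} n ns → x ∈ n ∷ ns → foldr _⊓_ n ns ≤ x
  foldr-⊓-≤ n []       (here refl)          = ≤-refl
  foldr-⊓-≤ n (m ∷ ms) (here refl)          = ≤-trans (m⊓n≤n m _) (foldr-⊓-≤ n ms (here refl))
  foldr-⊓-≤ n (m ∷ ms) (there (here refl))  = m⊓n≤m m _
  foldr-⊓-≤ n (m ∷ ms) (there (there x∈ms)) = ≤-trans (m⊓n≤n m _) (foldr-⊓-≤ n ms (there x∈ms))

-- The membership only excludes ns = [], where minL returns the junk value 0.
≤-minL : ∀ {d x ns} → x ∈ ns → All (d ≤_) ns → d ≤ minL ns
≤-minL {ns = _ ∷ _} _ (d≤n ∷ d≤ns) = foldr-preservesᵇ ⊓-glb d≤n d≤ns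

maxL-≤ : ∀ {B ns} → All (_≤ B) ns → maxL ns ≤ B
maxL-≤ = foldr-preservesᵇ ⊔-lub z≤n

compsF-⊆ : ∀ n F {K} → K ∈ compsF n F → K ⊆ F
compsF-⊆ (suc n) (c ∷ F) (here refl) (here refl)  = here refl
compsF-⊆ (suc n) (c ∷ F) (here refl) (there d∈)   = there (proj₁ (∈-filter⁻ _ d∈))
compsF-⊆ (suc n) (c ∷ F) (there K∈)  d∈           = there (proj₁ (∈-filter⁻ _ (compsF-⊆ n _ K∈ d∈)))

Conn-⊆ : ∀ F {K} → K ∈ Conn F → K ⊆ F
Conn-⊆ F = compsF-⊆ (length F) F

compsF-covers : ∀ n F → length F ≤ n → ∀ {d} → d ∈ F → ∃ λ K → K ∈ compsF n F × d ∈ K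
compsF-covers (suc n) (c ∷ F) _          (here refl) = _ , here refl , here refl
compsF-covers (suc n) (c ∷ F) (s≤s |F|≤n) {d} (there d∈F) with closeV (length F) (varsC c) F
... | V with T? (sharesᵇ V d)
... | yes shared = _ , here refl , there (∈-filter⁺ (λ d → T? (sharesᵇ V d)) d∈F shared)
... | no unshared =
  let K , K∈ , d∈K = compsF-covers n _ (≤-trans (length-filter _ F) |F|≤n)
                       (∈-filter⁺ (λ d → T? (not (sharesᵇ V d))) d∈F (¬T⇒T-not unshared))
  in K , there K∈ , d∈K
  where
  ¬T⇒T-not : ∀ {b} → ¬ T b → T (not b)
  ¬T⇒T-not {false} _  = tt
  ¬T⇒T-not {true}  ¬t = ¬t tt

Conn-covers : ∀ F {c} → c ∈ F → ∃ λ K → K ∈ Conn F × c ∈ K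
Conn-covers F = compsF-covers (length F) F ≤-refl

module Colouring (colour : ℕ → ℕ) where

  Within : ℕ → List ℕ → Set
  Within j V = ∀ {y} → y ∈ V → colour y ≡ j

  Monochromatic : Clause → Set
  Monochromatic c = ∃ λ j → Within j (varsC c)

  within-sharing : ∀ {j V e} → Within j V → Monochromatic e → T (sharesᵇ V e) → Within j (varsC e)
  within-sharing {V = V} {e} V⊆j (i , e⊆i) shared y∈e with find (any⁻ (λ l → memᵇ (var l) V) e shared)
  ... | l , l∈e , l∈V = trans (e⊆i y∈e) (trans (sym (e⊆i (∈-map⁺ var l∈e))) (V⊆j (∈-memᵇ⁻ l∈V)))

  within-closeV : ∀ {j} k V F → (∀ {e} → e ∈ F → Monochromatic e) → Within j V → Within j (closeV k V F)
  within-closeV zero    V F mono V⊆j = V⊆j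
  within-closeV (suc k) V F mono V⊆j = within-closeV k _ F mono grown
    where
    grown : Within _ (V ++ vars (filter (λ c → T? (sharesᵇ V c)) F))
    grown y∈ with ∈-++⁻ V y∈
    ... | inj₁ y∈V = V⊆j y∈V
    ... | inj₂ y∈vars with ∈-vars⁻ (filter (λ c → T? (sharesᵇ V c)) F) y∈vars
    ... | e , e∈ , y∈e with ∈-filter⁻ (λ c → T? (sharesᵇ V c)) {xs = F} e∈
    ... | e∈F , shared = within-sharing V⊆j (mono e∈F) shared y∈e

  compsF-monochromatic : ∀ n F → (∀ {e} → e ∈ F → Monochromatic e) →
                         ∀ {K} → K ∈ compsF n F → ∃ λ j → Within j (vars K)
  compsF-monochromatic (suc n) (c ∷ F) mono (here refl) = j , component
    where
    j = proj₁ (mono (here refl))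
    V = closeV (length F) (varsC c) F
    V⊆j : Within j V
    V⊆j = within-closeV (length F) (varsC c) F (λ e∈ → mono (there e∈)) (proj₂ (mono (here refl)))
    component : Within j (vars (c ∷ filter (λ d → T? (sharesᵇ V d)) F))
    component y∈ with ∈-vars⁻ (c ∷ filter (λ d → T? (sharesᵇ V d)) F) y∈
    ... | e , here refl , y∈e = proj₂ (mono (here refl)) y∈e
    ... | e , there e∈ , y∈e with ∈-filter⁻ (λ d → T? (sharesᵇ V d)) {xs = F} e∈
    ... | e∈F , shared = within-sharing V⊆j (mono (there e∈F)) shared y∈e
  compsF-monochromatic (suc n) (c ∷ F) mono (there K∈) =
    compsF-monochromatic n _ (λ e∈ → mono (there (proj₁ (∈-filter⁻ _ {xs = F} e∈)))) K∈

  Conn-monochromatic : ∀ F → (∀ {e} → e ∈ F → Monochromatic e) →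
                       ∀ {K} → K ∈ Conn F → ∃ λ j → Within j (vars K)
  Conn-monochromatic F = compsF-monochromatic (length F) F

-- Upper bounds on the depth

branchDepth : BaseClass → ℕ → CNF → ℕ → ℕ
branchDepth 𝒞 n F x = depthF 𝒞 n (F [ x ≔ false ]) ⊔ depthF 𝒞 n (F [ x ≔ true ])

DepthBoundedBySupport : BaseClass → ℕ → Set
DepthBoundedBySupport 𝒞 n = ∀ G S → vars G ⊆ S → depthF 𝒞 n G ≤ length S

branching-≤ : ∀ 𝒞 n F S → DepthBoundedBySupport 𝒞 n → ¬ F ∈𝒞 𝒞 → vars F ⊆ S →
              suc (minL (map (branchDepth 𝒞 n F) (vars F))) ≤ length S
branching-≤ 𝒞 n F S bounded F∉𝒞 F⊆S =
  ≤-trans (s≤s (≤-trans (minL-≤ (∈-map⁺ (branchDepth 𝒞 n F) x∈F))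
                        (⊔-lub (restriction-≤ false) (restriction-≤ true))))
          (length-remove-< (F⊆S x∈F))
  where
  x = proj₁ (∉𝒞⇒∃var 𝒞 F F∉𝒞)
  x∈F = proj₂ (∉𝒞⇒∃var 𝒞 F F∉𝒞)
  restriction-≤ : ∀ ε → depthF 𝒞 n (F [ x ≔ ε ]) ≤ length (remove x S)
  restriction-≤ ε = bounded _ _ λ y∈ →
    let y∈F , y≢x = vars-restrict F ε y∈ in ∈-remove⁺ (F⊆S y∈F) y≢x

depthF-suc-≤ : ∀ 𝒞 n F {B} → DepthBoundedBySupport 𝒞 n →
               (∀ {K} → K ∈ Conn F → ∃ λ S → vars K ⊆ S × length S ≤ B) →
               depthF 𝒞 (suc n) F ≤ B
depthF-suc-≤ 𝒞 n F bounded supported with F ∈𝒞? 𝒞 | Conn F | Conn-covers F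
... | yes _   | _              | _      = z≤n
... | no _    | []             | _      = z≤n
... | no F∉𝒞 | K ∷ []         | covers =
  let S , K⊆S , |S|≤B = supported (here refl) in
  ≤-trans (branching-≤ 𝒞 n F S bounded F∉𝒞 (λ y∈ → K⊆S (vars-mono F⊆K y∈))) |S|≤B
  where
  F⊆K : F ⊆ K
  F⊆K c∈F with covers c∈F
  ... | _ , here refl , c∈K = c∈K
... | no _    | Ks@(_ ∷ _ ∷ _) | _      = maxL-≤ (All.map⁺ (All.tabulate λ K∈ →
  let S , K⊆S , |S|≤B = supported K∈ in ≤-trans (bounded _ S K⊆S) |S|≤B))

depthF-≤-support : ∀ 𝒞 n → DepthBoundedBySupport 𝒞 n
depthF-≤-support 𝒞 zero    F S F⊆S = z≤n
depthF-≤-support 𝒞 (suc n) F S F⊆S =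
  depthF-suc-≤ 𝒞 n F (depthF-≤-support 𝒞 n) λ K∈ →
    S , (λ y∈ → F⊆S (vars-mono (Conn-⊆ F K∈) y∈)) , ≤-refl

depthF-≤-colourClass : ∀ 𝒞 n F (colour : ℕ → ℕ) (class : ℕ → List ℕ) {B} →
  (∀ y → y ∈ class (colour y)) → (∀ j → length (class j) ≤ B) →
  (∀ {e} → e ∈ F → Colouring.Monochromatic colour e) → depthF 𝒞 n F ≤ B
depthF-≤-colourClass 𝒞 zero    F colour class ∈class small mono = z≤n
depthF-≤-colourClass 𝒞 (suc n) F colour class ∈class small mono =
  depthF-suc-≤ 𝒞 n F (depthF-≤-support 𝒞 n) λ K∈ →
    let j , K⊆j = Conn-monochromatic F mono K∈ in
    class j , (λ {y} y∈ → subst (λ i → y ∈ class i) (K⊆j y∈) (∈class y)) , small j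
  where open Colouring colour

-- A single wide monotone clause

literal : Bool → ℕ → Lit
literal true  = pos
literal false = neg

monotone : Bool → List ℕ → Clause
monotone b = map (literal b)

literal-injective : ∀ b {y z} → literal b y ≡ literal b z → y ≡ z
literal-injective true  refl = refl
literal-injective false refl = refl

wideSign : BaseClass → Bool
wideSign horn  = true
wideSign dhorn = false
wideSign krom  = true

countPos-monotone : ∀ xs → countPos (monotone true xs) ≡ length xs
countPos-monotone []       = refl
countPos-monotone (_ ∷ xs) = cong suc (countPos-monotone xs)

countNeg-monotone : ∀ xs → countNeg (monotone false xs) ≡ length xs
countNeg-monotone []       = refl
countNeg-monotone (_ ∷ xs) = cong suc (countNeg-monotone xs)

monotone-∈𝒞⇒short : ∀ 𝒞 xs → (monotone (wideSign 𝒞) xs ∷ []) ∈𝒞 𝒞 → length xs ≤ 2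
monotone-∈𝒞⇒short horn  xs (p ∷ []) = m≤n⇒m≤1+n (subst (_≤ 1) (countPos-monotone xs) p)
monotone-∈𝒞⇒short dhorn xs (p ∷ []) = m≤n⇒m≤1+n (subst (_≤ 1) (countNeg-monotone xs) p)
monotone-∈𝒞⇒short krom  xs (p ∷ []) = subst (_≤ 2) (length-map pos xs) p

monotone-unsatisfied : ∀ b x xs → any (trueLitᵇ x (not b)) (monotone b xs) ≡ false
monotone-unsatisfied b     x []       = refl
monotone-unsatisfied true  x (y ∷ ys) rewrite ∧-zeroʳ (y ≡ᵇ x) = monotone-unsatisfied true x ys
monotone-unsatisfied false x (y ∷ ys) rewrite ∧-zeroʳ (y ≡ᵇ x) = monotone-unsatisfied false x ys

filter-monotone : ∀ b x xs → filter (λ l → T? (not (var l ≡ᵇ x))) (monotone b xs) ≡ monotone b (remove x xs)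
filter-monotone b     x []       = refl
filter-monotone true  x (y ∷ ys) with y ≡ᵇ x
... | true  = filter-monotone true x ys
... | false = cong (pos y ∷_) (filter-monotone true x ys)
filter-monotone false x (y ∷ ys) with y ≡ᵇ x
... | true  = filter-monotone false x ys
... | false = cong (neg y ∷_) (filter-monotone false x ys)

restrict-monotone : ∀ b x xs → (monotone b xs ∷ []) [ x ≔ not b ] ≡ monotone b (remove x xs) ∷ []
restrict-monotone b x xs rewrite monotone-unsatisfied b x xs = cong (_∷ []) (filter-monotone b x xs)

restriction-≤-branchDepth : ∀ 𝒞 n F x ε → depthF 𝒞 n (F [ x ≔ ε ]) ≤ branchDepth 𝒞 n F x
restriction-≤-branchDepth 𝒞 n F x false = m≤m⊔n _ _
restriction-≤-branchDepth 𝒞 n F x true  = m≤n⊔m _ _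

depthF-monotone-≥ : ∀ 𝒞 n d xs → Unique xs → 2 + d < length xs → d ≤ n →
                    d ≤ depthF 𝒞 n (monotone (wideSign 𝒞) xs ∷ [])
depthF-monotone-≥ 𝒞 n       zero    xs _      _    _         = z≤n
depthF-monotone-≥ 𝒞 (suc n) (suc d) xs unique wide (s≤s d≤n)
  with (monotone (wideSign 𝒞) xs ∷ []) ∈𝒞? 𝒞
... | yes F∈𝒞 = ⊥-elim (<⇒≱ wide (≤-trans (monotone-∈𝒞⇒short 𝒞 xs F∈𝒞) (m≤m+n 2 (suc d))))
... | no F∉𝒞  = s≤s (≤-minL (∈-map⁺ (branchDepth 𝒞 n F) (proj₂ (∉𝒞⇒∃var 𝒞 F F∉𝒞)))
                         (All.map⁺ (All.universal branch (vars F))))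
  where
  b = wideSign 𝒞
  F = monotone b xs ∷ []
  branch : ∀ z → d ≤ branchDepth 𝒞 n F z
  branch z = ≤-trans
    (subst (λ G → d ≤ depthF 𝒞 n G) (sym (restrict-monotone b z xs))
      (depthF-monotone-≥ 𝒞 n d (remove z xs) (Unique.filter⁺ (λ y → T? (not (y ≡ᵇ z))) unique)
        (≤-pred (≤-trans wide (length≤1+length-remove z unique))) d≤n))
    (restriction-≤-branchDepth 𝒞 n F z (not b))

length-vars-singleton : ∀ c → length (vars (c ∷ [])) ≡ length c
length-vars-singleton c = trans (cong length (++-identityʳ (map var c))) (length-map var c)

depth-monotone-≥ : ∀ 𝒞 d xs → Unique xs → 2 + d < length xs →
                   d ≤ depth 𝒞 (monotone (wideSign 𝒞) xs ∷ [])
depth-monotone-≥ 𝒞 d xs unique wide = depthF-monotone-≥ 𝒞 _ d xs unique wide enoughFuel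
  where
  c = monotone (wideSign 𝒞) xs
  L = length (vars (c ∷ []))
  open ≤-Reasoning
  enoughFuel : d ≤ 2 * L + 2
  enoughFuel = begin
    d          ≤⟨ m≤n+m d 2 ⟩
    2 + d      <⟨ wide ⟩
    length xs  ≡⟨ sym (trans (length-vars-singleton c) (length-map (literal (wideSign 𝒞)) xs)) ⟩
    L          ≤⟨ m≤m+n L (L + 0) ⟩
    2 * L      ≤⟨ m≤m+n (2 * L) 2 ⟩
    2 * L + 2  ∎

falsifying : Bool → ℚ
falsifying true  = 0ℚ
falsifying false = 1ℚ

clauseSum-falsifying : ∀ b xs → clauseSum (λ _ → falsifying b) (monotone b xs) ≡ 0ℚ
clauseSum-falsifying b     []       = refl
clauseSum-falsifying true  (_ ∷ xs) = cong (0ℚ ℚ.+_) (clauseSum-falsifying true xs)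
clauseSum-falsifying false (_ ∷ xs) = cong₂ ℚ._+_ (ℚ.+-inverseʳ 1ℚ) (clauseSum-falsifying false xs)

0≤1 : 0ℚ ℚ.≤ 1ℚ
0≤1 = toWitness {a? = 0ℚ ℚ.≤? 1ℚ} tt

monotone-QHorn : ∀ b xs → QHorn (monotone b xs ∷ [])
monotone-QHorn b xs =
  (λ _ → falsifying b) , (λ _ _ → bounds b) , subst (ℚ._≤ 1ℚ) (sym (clauseSum-falsifying b xs)) 0≤1 ∷ []
  where
  bounds : ∀ b → (0ℚ ℚ.≤ falsifying b) × (falsifying b ℚ.≤ 1ℚ)
  bounds true  = ℚ.≤-refl , 0≤1
  bounds false = 0≤1 , ℚ.≤-refl

-ᵛ-[] : ∀ F → F -ᵛ [] ≡ F
-ᵛ-[] []      = refl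
-ᵛ-[] (c ∷ F) = cong₂ _∷_ (filter-all _ (All.universal (λ _ → tt) c)) (-ᵛ-[] F)

monotone-DelQHornLe-0 : ∀ b xs → DelQHornLe 0 (monotone b xs ∷ [])
monotone-DelQHornLe-0 b xs = [] , z≤n , [] , subst QHorn (sym (-ᵛ-[] _)) (monotone-QHorn b xs)

monotone-WFClause : ∀ b {xs} → Unique xs → WFClause (monotone b xs)
monotone-WFClause b unique = Unique.map⁺ (literal-injective b) unique , noComplementary b
  where
  noComplementary : ∀ b {xs} x → ¬ (pos x ∈ monotone b xs × neg x ∈ monotone b xs)
  noComplementary true  x (_ , neg∈) with ∈-map⁻ pos neg∈
  ... | _ , _ , ()
  noComplementary false x (pos∈ , _) with ∈-map⁻ neg pos∈
  ... | _ , _ , ()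

open +-*-Solver using (solve; _:+_; _:-_; con; _:=_)

complementary-¬QHorn : ∀ {F} a b c →
  monotone true (a ∷ b ∷ c ∷ []) ∈ F → monotone false (a ∷ b ∷ c ∷ []) ∈ F → ¬ QHorn F
complementary-¬QHorn {F} a b c pos∈ neg∈ (f , _ , sums≤1) =
  3≰2 (subst (ℚ._≤ 1ℚ ℚ.+ 1ℚ) (sums≡3 (f a) (f b) (f c))
             (ℚ.+-mono-≤ (All.lookup sums≤1 pos∈) (All.lookup sums≤1 neg∈)))
  where
  sums≡3 : ∀ p q r → (p ℚ.+ (q ℚ.+ (r ℚ.+ 0ℚ)))
                     ℚ.+ ((1ℚ ℚ.- p) ℚ.+ ((1ℚ ℚ.- q) ℚ.+ ((1ℚ ℚ.- r) ℚ.+ 0ℚ)))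
                   ≡ 1ℚ ℚ.+ (1ℚ ℚ.+ 1ℚ)
  sums≡3 = solve 3 (λ p q r → (p :+ (q :+ (r :+ con 0ℚ)))
                                :+ ((con 1ℚ :- p) :+ ((con 1ℚ :- q) :+ ((con 1ℚ :- r) :+ con 0ℚ)))
                              := con 1ℚ :+ (con 1ℚ :+ con 1ℚ)) refl
  3≰2 : ¬ (1ℚ ℚ.+ (1ℚ ℚ.+ 1ℚ) ℚ.≤ 1ℚ ℚ.+ 1ℚ)
  3≰2 = toWitnessFalse {a? = 1ℚ ℚ.+ (1ℚ ℚ.+ 1ℚ) ℚ.≤? 1ℚ ℚ.+ 1ℚ} tt

∈-untouched : ∀ {c F B} → c ∈ F → All (λ l → var l ∉ B) c → c ∈ F -ᵛ B
∈-untouched {c} {F} {B} c∈F untouched =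
  subst (_∈ F -ᵛ B) (filter-all P? (All.map ∉⇒T-not-memᵇ untouched)) (∈-map⁺ (filter P?) c∈F)
  where
  P? = λ (l : Lit) → T? (not (memᵇ (var l) B))

missing-≤ : ∀ n D → length D ≤ n → ∃ λ j → j ≤ n × j ∉ D
missing-≤ zero    []    _     = 0 , z≤n , λ ()
missing-≤ (suc n) D |D|≤1+n with suc n ∈? D
... | no 1+n∉D = suc n , ≤-refl , 1+n∉D
... | yes 1+n∈D with missing-≤ n (remove (suc n) D) (≤-pred (≤-trans (length-remove-< 1+n∈D) |D|≤1+n))
... | j , j≤n , j∉D = j , m≤n⇒m≤1+n j≤n , λ j∈D → j∉D (∈-remove⁺ j∈D λ { refl → 1+n≰n j≤n })

-- Disjoint complementary triples

triple : ℕ → List ℕ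
triple j = j * 3 ∷ suc (j * 3) ∷ suc (suc (j * 3)) ∷ []

[r+j*3]/3≡j : ∀ j r → r < 3 → (r + j * 3) / 3 ≡ j
[r+j*3]/3≡j j r r<3 = trans (+-distrib-/-∣ʳ r (divides j refl)) (cong₂ _+_ (m<n⇒m/n≡0 r<3) (m*n/n≡m j 3))

triple-/3 : ∀ j {y} → y ∈ triple j → y / 3 ≡ j
triple-/3 j (here refl)                 = [r+j*3]/3≡j j 0 (s≤s z≤n)
triple-/3 j (there (here refl))         = [r+j*3]/3≡j j 1 (s≤s (s≤s z≤n))
triple-/3 j (there (there (here refl))) = [r+j*3]/3≡j j 2 (s≤s (s≤s (s≤s z≤n)))

∈-triple : ∀ y → y ∈ triple (y / 3)
∈-triple y with y % 3 | m≡m%n+[m/n]*n y 3 | m%n<n y 3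
... | 0 | y≡ | _ = subst (_∈ triple (y / 3)) (sym y≡) (here refl)
... | 1 | y≡ | _ = subst (_∈ triple (y / 3)) (sym y≡) (there (here refl))
... | 2 | y≡ | _ = subst (_∈ triple (y / 3)) (sym y≡) (there (there (here refl)))
... | suc (suc (suc _)) | _ | s≤s (s≤s (s≤s ()))

triple-unique : ∀ j → Unique (triple j)
triple-unique j =
  (<⇒≢ (s≤s ≤-refl) ∷ <⇒≢ (s≤s (m≤n⇒m≤1+n ≤-refl)) ∷ []) ∷ (<⇒≢ (s≤s ≤-refl) ∷ []) ∷ [] ∷ []

complementaryTriples : ℕ → CNF
complementaryTriples zero    = []
complementaryTriples (suc m) = monotone true (triple m) ∷ monotone false (triple m) ∷ complementaryTriples m

complementaryTriples-WF : ∀ m → WF (complementaryTriples m)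
complementaryTriples-WF zero    = []
complementaryTriples-WF (suc m) =
  monotone-WFClause true (triple-unique m) ∷ monotone-WFClause false (triple-unique m) ∷ complementaryTriples-WF m

∈-complementaryTriples : ∀ {j m} → j < m →
  monotone true (triple j) ∈ complementaryTriples m × monotone false (triple j) ∈ complementaryTriples m
∈-complementaryTriples {j} {suc m} j<1+m with m<1+n⇒m<n∨m≡n j<1+m
... | inj₂ refl = here refl , there (here refl)
... | inj₁ j<m  = let pos∈ , neg∈ = ∈-complementaryTriples j<m in there (there pos∈) , there (there neg∈)

depth-complementaryTriples-≤ : ∀ 𝒞 m → depth 𝒞 (complementaryTriples m) ≤ 3
depth-complementaryTriples-≤ 𝒞 m =
  depthF-≤-colourClass 𝒞 (2 * length (vars (complementaryTriples m)) + 2) (complementaryTriples m)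
    (_/ 3) triple ∈-triple (λ _ → ≤-refl) (monochromatic m)
  where
  open Colouring (_/ 3)
  monochromatic : ∀ m {c} → c ∈ complementaryTriples m → Monochromatic c
  monochromatic (suc m) (here refl)         = m , triple-/3 m
  monochromatic (suc m) (there (here refl)) = m , triple-/3 m
  monochromatic (suc m) (there (there c∈))  = monochromatic m c∈

¬DelQHornLe-complementaryTriples : ∀ k → ¬ DelQHornLe k (complementaryTriples (suc k))
¬DelQHornLe-complementaryTriples k (B , |B|≤k , _ , qhorn)
  with missing-≤ k (map (_/ 3) B) (subst (_≤ k) (sym (length-map (_/ 3) B)) |B|≤k)
... | j , j≤k , j∉B/3 =
  complementary-¬QHorn _ _ _ (∈-untouched pos∈ (untouched true)) (∈-untouched neg∈ (untouched false)) qhorn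
  where
  pos∈ = proj₁ (∈-complementaryTriples (s≤s j≤k))
  neg∈ = proj₂ (∈-complementaryTriples (s≤s j≤k))
  ∉B : ∀ {y} → y ∈ triple j → y ∉ B
  ∉B y∈ y∈B = j∉B/3 (subst (_∈ map (_/ 3) B) (triple-/3 j y∈) (∈-map⁺ (_/ 3) y∈B))
  untouched : ∀ b → All (λ l → var l ∉ B) (monotone b (triple j))
  untouched true  = ∉B (here refl) ∷ ∉B (there (here refl)) ∷ ∉B (there (there (here refl))) ∷ []
  untouched false = ∉B (here refl) ∷ ∉B (there (here refl)) ∷ ∉B (there (there (here refl))) ∷ []

WideClause : BaseClass → CNF → Set
WideClause 𝒞 F = ∃ λ xs → Unique xs × F ≡ monotone (wideSign 𝒞) xs ∷ []

ComplementaryTriples : CNF → Set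
ComplementaryTriples F = ∃ λ m → F ≡ complementaryTriples m

delQHorn-bounded-on-wideClauses : ∀ 𝒞 → BoundedOn DelQHornLe (WideClause 𝒞)
delQHorn-bounded-on-wideClauses 𝒞 = 0 , λ { _ _ (xs , _ , refl) → monotone-DelQHornLe-0 (wideSign 𝒞) xs }

depth-unbounded-on-wideClauses : ∀ 𝒞 → ¬ BoundedOn (DepthLe 𝒞) (WideClause 𝒞)
depth-unbounded-on-wideClauses 𝒞 (k , bounded) =
  1+n≰n (≤-trans (depth-monotone-≥ 𝒞 (suc k) xs unique wide) (bounded _ wf (xs , unique , refl)))
  where
  xs = upTo (4 + k)
  unique = Unique.upTo⁺ (4 + k)
  wide : 2 + suc k < length xs
  wide = ≤-reflexive (sym (length-upTo (4 + k)))
  wf = monotone-WFClause (wideSign 𝒞) unique ∷ []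

depth-bounded-on-complementaryTriples : ∀ 𝒞 → BoundedOn (DepthLe 𝒞) ComplementaryTriples
depth-bounded-on-complementaryTriples 𝒞 = 3 , λ { _ _ (m , refl) → depth-complementaryTriples-≤ 𝒞 m }

delQHorn-unbounded-on-complementaryTriples : ¬ BoundedOn DelQHornLe ComplementaryTriples
delQHorn-unbounded-on-complementaryTriples (k , bounded) =
  ¬DelQHornLe-complementaryTriples k
    (bounded _ (complementaryTriples-WF (suc k)) (suc k , refl))

mainTheorem18 : ∀ (𝒞 : BaseClass) → DominationOrthogonal (DepthLe 𝒞) DelQHornLe
mainTheorem18 𝒞 =
  (λ depth-dominates → depth-unbounded-on-wideClauses 𝒞
     (depth-dominates _ (delQHorn-bounded-on-wideClauses 𝒞))) ,
  (λ del-dominates → delQHorn-unbounded-on-complementaryTriples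
     (del-dominates _ (depth-bounded-on-complementaryTriples 𝒞)))
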